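{- Let $\sigma,\sigma'$ be configurations of a threshold automaton and suppose $\phi_{\mathit{steady}}(\sigma,\sigma')$ holds with assignment $Y=(y_r)_{r\in\mathcal R}$. Suppose $\sigma.\kappa(\ell)>0$ for a location $\ell$ and there is a fireable cycle $t_1,\dots,t_m$ at $\ell$ with respect to $Y$. Then $\phi_{\mathit{steady}}(t_1(\sigma),\sigma')$ holds with some assignment $Z$ such that $Z<Y$.
   Context: A threshold automaton $\mathsf{TA}=(\mathcal L,\mathcal I,\Gamma,\mathcal R)$ over environment $(\Pi,RC,N)$ ($\Pi$ parameters over $\mathbb N_0$, $RC\subseteq\mathbb N_0^\Pi$ integer-linear-definable, $N$ linear) has locations $\mathcal L$, shared variables $\Gamma$ over $\mathbb N_0$, and rules $r=(r.\mathit{from},r.\mathit{to},r.\varphi,r.\vec u)$ with $r.\varphi$ a conjunction of threshold guards (rise: $x\ge a_0+\sum_ia_ip_i$; fall: $x<a_0+\sum_ia_ip_i$; $x\in\Gamma,p_i\in\Pi,a_i\in\mathbb Q$) and $r.\vec u\in\{0,1\}^\Gamma$. A configuration $\sigma=(\sigma.\kappa,\sigma.\vec g,\sigma.\vec p)$ has $\sigma.\kappa\colon\mathcal L\to\mathbb N_0$, $\sigma.\vec g\in\mathbb N_0^\Gamma$, $\sigma.\vec p\in RC$, $\sum_\ell\sigma.\kappa(\ell)=N(\sigma.\vec p)$. $\sigma\models r.\varphi$ means $(\sigma.\vec g,\sigma.\vec p)$ satisfies $r.\varphi$. If $\sigma.\kappa(r.\mathit{from})>0$ and $\sigma\models r.\varphi$,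 then $r(\sigma)$ keeps parameters, has shared values $\sigma.\vec g+r.\vec u$ and moves one process from $r.\mathit{from}$ to $r.\mathit{to}$. The context $\omega(\sigma)$ is the set of rise guards of $\mathsf{TA}$ true in $\sigma$ plus fall guards false in $\sigma$. For configurations $\sigma,\sigma'$ and $X=(x_r)_{r\in\mathcal R}\in\mathbb N_0^{\mathcal R}$ consider: (base) $\sigma.\vec p=\sigma'.\vec p$, $\sigma.\vec p\in RC$, $N(\sigma.\vec p)=N(\sigma'.\vec p)$, $\omega(\sigma)=\omega(\sigma')$; (L) for all $\ell$: $\sum_{r.\mathit{to}=\ell}x_r-\sum_{r.\mathit{from}=\ell}x_r=\sigma'.\kappa(\ell)-\sigma.\kappa(\ell)$; ($\Gamma$) for all $z\in\Gamma$: $\sum_rx_r\,r.\vec u[z]=\sigma'.\vec g[z]-\sigma.\vec g[z]$; (R) $x_r>0\Rightarrow\sigma\models r.\varphi$ for all $r$; (appl) for every $r$ with $x_r>0$ there are rules $r_1,\dots,r_s$ with all $x_{r_i}>0$, $\sigma.\kappa(r_1.\mathit{from})>0$, $r_{i-1}.\mathit{to}=r_i.\mathit{from}$ for $1<i\le s$, $r_s=r$. $\phi_{\mathit{steady}}(\sigma,\sigma')\equiv(\text{base})\wedge\exists X\ge0[(\text{L})\wedge(\Gamma)\wedge(\text{R})\wedge(\text{appl})]$. "$\phi_{\mathit{steady}}(\sigma,\sigma')$ holds with assignment $Y=(y_r)$" means (base) holds and (L),($\Gamma$),(R),(appl) hold for $x_r=y_r$. $Z<Y$ means $\sum_rz_r<\sum_ry_r$.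 A fireable cycle at $\ell$ with respect to $Y$ is a sequence of rules $t_1,\dots,t_m$ with $y_{t_1},\dots,y_{t_m}>0$, $t_i.\mathit{to}=t_{i+1}.\mathit{from}$ for $i<m$, and $t_m.\mathit{to}=t_1.\mathit{from}=\ell$. -}

module Defs where

open import Data.Nat as ℕ using (ℕ; zero; suc)
open import Data.Integer as ℤ using (ℤ; +_)
open import Data.Rational as ℚ using (ℚ)
open import Data.Fin using (Fin; zero; suc; _≟_)
open import Data.Bool using (Bool; true; false; if_then_else_)
open import Data.List using (List; []; _∷_)
open import Data.List.Relation.Unary.All using (All)
open import Data.Product using (Σ; _×_; ∃; _,_)
open import Data.Unit using (⊤)
open import Relation.Binary.PropositionalEquality using (_≡_)
open import Relation.Nullary.Decidable using (⌊_⌋)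
open import Function.Bundles using (_⇔_)

sumFin : ∀ {A : Set} → A → (A → A → A) → (n : ℕ) → (Fin n → A) → A
sumFin z _ zero    f = z
sumFin z _⊕_ (suc n) f = f zero ⊕ sumFin z _⊕_ n (λ i → f (suc i))

Σℕ : (n : ℕ) → (Fin n → ℕ) → ℕ
Σℕ = sumFin 0 ℕ._+_

Σℤ : (n : ℕ) → (Fin n → ℤ) → ℤ
Σℤ = sumFin (+ 0) ℤ._+_

Σℚ : (n : ℕ) → (Fin n → ℚ) → ℚ
Σℚ = sumFin ℚ.0ℚ ℚ._+_

ℕ→ℚ : ℕ → ℚ
ℕ→ℚ n = (+ n) ℚ./ 1

ℕ→ℤ : ℕ → ℤ
ℕ→ℤ n = + n

data GuardKind : Set where
  rise fall : GuardKind

record Guard (nΓ nΠ : ℕ) : Set where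
  field
    kind  : GuardKind
    var   : Fin nΓ
    a₀    : ℚ
    coeff : Fin nΠ → ℚ

threshold : ∀ {nΓ nΠ} → Guard nΓ nΠ → (Fin nΠ → ℕ) → ℚ
threshold {nΠ = nΠ} g p =
  Guard.a₀ g ℚ.+ Σℚ nΠ (λ i → Guard.coeff g i ℚ.* ℕ→ℚ (p i))

SatGuard : ∀ {nΓ nΠ} → Guard nΓ nΠ → (Fin nΓ → ℕ) → (Fin nΠ → ℕ) → Set
SatGuard g gv p with Guard.kind g
... | rise = threshold g p ℚ.≤ ℕ→ℚ (gv (Guard.var g))
... | fall = ℕ→ℚ (gv (Guard.var g)) ℚ.< threshold g p

record Rule (nL nΓ nΠ : ℕ) : Set where
  field
    from  : Fin nL
    to    : Fin nL
    guard : List (Guard nΓ nΠ)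
    upd   : Fin nΓ → Bool

b2n : Bool → ℕ
b2n true  = 1
b2n false = 0

record LinIneq (nΠ : ℕ) : Set where
  field
    c₀ : ℤ
    c  : Fin nΠ → ℤ

linVal : ∀ {nΠ} → ℤ → (Fin nΠ → ℤ) → (Fin nΠ → ℕ) → ℤ
linVal {nΠ} c₀ c p = c₀ ℤ.+ Σℤ nΠ (λ i → c i ℤ.* ℕ→ℤ (p i))

SatIneq : ∀ {nΠ} → LinIneq nΠ → (Fin nΠ → ℕ) → Set
SatIneq e p = + 0 ℤ.≤ linVal (LinIneq.c₀ e) (LinIneq.c e) p

record TA : Set where
  field
    nL nΓ nΠ nR : ℕ
    initial  : Fin nL → Bool             -- I (not used by the lemma)
    rules    : Fin nR → Rule nL nΓ nΠ
    RC       : List (LinIneq nΠ)         -- resilience condition (conjunction of linear constraints)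
    N₀       : ℤ                         -- N(p) = N₀ + Σ Nc_i p_i
    Nc       : Fin nΠ → ℤ

module _ (A : TA) where
  open TA A

  Loc = Fin nL
  RuleIx = Fin nR

  from : RuleIx → Loc
  from r = Rule.from (rules r)

  to : RuleIx → Loc
  to r = Rule.to (rules r)

  InRC : (Fin nΠ → ℕ) → Set
  InRC p = All (λ e → SatIneq e p) RC

  Nval : (Fin nΠ → ℕ) → ℤ
  Nval p = linVal N₀ Nc p

  record Conf : Set where
    constructor conf
    field
      κ : Fin nL → ℕ
      g : Fin nΓ → ℕ
      p : Fin nΠ → ℕ

  open Conf public

  IsConfig : Conf → Set
  IsConfig σ = InRC (p σ) × ℕ→ℤ (Σℕ nL (κ σ)) ≡ Nval (p σ)

  SatRule : Conf → RuleIx → Set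
  SatRule σ r = All (λ gd → SatGuard gd (g σ) (p σ)) (Rule.guard (rules r))

  SameContext : Conf → Conf → Set
  SameContext σ σ' = (r : RuleIx) →
    All (λ gd → SatGuard gd (g σ) (p σ) ⇔ SatGuard gd (g σ') (p σ')) (Rule.guard (rules r))

  ind : Loc → Loc → ℕ
  ind a b = if ⌊ a ≟ b ⌋ then 1 else 0

  -- r(σ) (meaningful when σ.κ(r.from) > 0 and σ ⊨ r.φ)
  applyRule : RuleIx → Conf → Conf
  applyRule r σ = conf
    (λ ℓ → (κ σ ℓ ℕ.∸ ind ℓ (from r)) ℕ.+ ind ℓ (to r))
    (λ z → g σ z ℕ.+ b2n (Rule.upd (rules r) z))
    (p σ)

  Assignment = RuleIx → ℕ

  total : Assignment → ℕ
  total X = Σℕ nR X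

  data ApplChain (σ : Conf) (X : Assignment) : RuleIx → Set where
    start : ∀ {r} → 0 ℕ.< X r → 0 ℕ.< κ σ (from r) → ApplChain σ X r
    step  : ∀ {r' r} → ApplChain σ X r' → 0 ℕ.< X r → to r' ≡ from r → ApplChain σ X r

  Base : Conf → Conf → Set
  Base σ σ' = ((i : Fin nΠ) → p σ i ≡ p σ' i) × InRC (p σ)
            × Nval (p σ) ≡ Nval (p σ') × SameContext σ σ'

  CondL : Conf → Conf → Assignment → Set
  CondL σ σ' X = (ℓ : Loc) →
    Σℤ nR (λ r → ℕ→ℤ (if ⌊ to r ≟ ℓ ⌋ then X r else 0))
      ℤ.- Σℤ nR (λ r → ℕ→ℤ (if ⌊ from r ≟ ℓ ⌋ then X r else 0))
    ≡ ℕ→ℤ (κ σ' ℓ) ℤ.- ℕ→ℤ (κ σ ℓ)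

  CondΓ : Conf → Conf → Assignment → Set
  CondΓ σ σ' X = (z : Fin nΓ) →
    ℕ→ℤ (Σℕ nR (λ r → X r ℕ.* b2n (Rule.upd (rules r) z)))
    ≡ ℕ→ℤ (g σ' z) ℤ.- ℕ→ℤ (g σ z)

  CondR : Conf → Assignment → Set
  CondR σ X = (r : RuleIx) → 0 ℕ.< X r → SatRule σ r

  CondAppl : Conf → Assignment → Set
  CondAppl σ X = (r : RuleIx) → 0 ℕ.< X r → ApplChain σ X r

  SteadyWith : Conf → Conf → Assignment → Set
  SteadyWith σ σ' X = Base σ σ' × CondL σ σ' X × CondΓ σ σ' X × CondR σ X × CondAppl σ X

  Linked : RuleIx → List RuleIx → Set
  Linked t []        = ⊤
  Linked t (t' ∷ ts) = to t ≡ from t' × Linked t' ts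

  lastOf : RuleIx → List RuleIx → RuleIx
  lastOf t []        = t
  lastOf t (t' ∷ ts) = lastOf t' ts

  -- fireable cycle t₁,…,t_m (t₁ = t, t₂… = ts) at ℓ with respect to Y
  FireableCycle : Assignment → Loc → RuleIx → List RuleIx → Set
  FireableCycle Y ℓ t ts =
    All (λ r → 0 ℕ.< Y r) (t ∷ ts) × Linked t ts × from t ≡ ℓ × to (lastOf t ts) ≡ ℓ

-- Z is Y with one firing of t₁ removed, and t₁(σ) is σ after exactly that firing, so
-- the flow equations for locations and for shared variables still balance. Shared
-- variables only grow, σ.g ≤ t₁(σ).g ≤ σ'.g, and every guard compares one of them
-- with a threshold that depends on the parameters alone; hence a guard with the same
-- truth value at σ and σ' has it at t₁(σ) as well, which preserves the context and
-- condition (R). For applicability, the only location that may have lost its last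
-- process is ℓ = t₁.from. But t₁(σ) has a process at t₁.to, and the cycle t₂,…,t_m
-- leads from there back to ℓ through rules that are still Z-positive (Z differs from Y
-- only at t₁, whose target is occupied anyway). So every location that was reachable
-- before is still reachable.
module Submission where

open import Defs
open import Data.Nat using (ℕ; zero; suc; _+_; _*_; _∸_; _≤_; _<_; z≤n; s≤s)
open import Data.Nat.Properties
  using (+-assoc; +-commutativeSemigroup; +-cancelʳ-≡; *-distribʳ-+; *-identityˡ;
         m∸n+n≡m; m∸n≤m; m≤m+n; m≤n+m; m<m+n; ≤-trans; ≤-reflexive; <-≤-trans; ≤-refl)
open import Algebra.Properties.CommutativeSemigroup +-commutativeSemigroup
  using (xy∙z≈xz∙y; x∙yz≈xz∙y)
open import Data.Integer using (ℤ; +≤+) renaming (_+_ to _+ℤ_; _-_ to _-ℤ_; _≤_ to _≤ℤ_)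
import Data.Integer.Properties as ℤ
open import Data.Integer.Tactic.RingSolver using (solve-∀)
open import Data.Rational as ℚ using (mkℚ)
import Data.Rational.Properties as ℚ
open import Data.Nat.Coprimality using (1-coprimeTo) renaming (sym to coprime-sym)
open import Data.Fin using (Fin; zero; suc; _≟_)
open import Data.Fin.Properties using (suc-injective)
open import Data.Bool using (true; false; if_then_else_)
open import Data.List using (List; []; _∷_)
open import Data.List.Relation.Unary.All as All using (All; []; _∷_)
open import Data.Product using (Σ; _×_; ∃-syntax; _,_)
open import Data.Sum using (_⊎_; inj₁; inj₂)
open import Relation.Binary.PropositionalEquality
open import Relation.Nullary using (yes; no; contradiction)
open import Relation.Nullary.Decidable using (⌊_⌋)
open import Function.Bundles using (_⇔_; mk⇔; Equivalence)

sumFin-cong : ∀ {A : Set} (z : A) (_⊕_ : A → A → A) n {f h : Fin n → A} →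
              f ≗ h → sumFin z _⊕_ n f ≡ sumFin z _⊕_ n h
sumFin-cong z _⊕_ zero    f≗h = refl
sumFin-cong z _⊕_ (suc n) f≗h = cong₂ _⊕_ (f≗h zero) (sumFin-cong z _⊕_ n (λ i → f≗h (suc i)))

Σℕ-differAt : ∀ {n} (t : Fin n) {f h : Fin n → ℕ} {d} →
              (∀ i → i ≢ t → f i ≡ h i) → f t ≡ h t + d → Σℕ n f ≡ Σℕ n h + d
Σℕ-differAt {suc n} zero    {h = h} {d} f≡h ft =
  trans (cong₂ _+_ ft (sumFin-cong 0 _+_ n (λ i → f≡h (suc i) λ ())))
        (xy∙z≈xz∙y (h zero) d _)
Σℕ-differAt {suc n} (suc t) {h = h} {d} f≡h ft =
  trans (cong₂ _+_ (f≡h zero λ ())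
                   (Σℕ-differAt t (λ i i≢t → f≡h (suc i) (λ e → i≢t (suc-injective e))) ft))
        (sym (+-assoc (h zero) _ d))

Σℤ-ℕ→ℤ : ∀ n (f : Fin n → ℕ) → Σℤ n (λ i → ℕ→ℤ (f i)) ≡ ℕ→ℤ (Σℕ n f)
Σℤ-ℕ→ℤ zero    f = refl
Σℤ-ℕ→ℤ (suc n) f = cong (ℕ→ℤ (f zero) +ℤ_) (Σℤ-ℕ→ℤ n (λ i → f (suc i)))

decrementAt : ∀ {n} → Fin n → (Fin n → ℕ) → Fin n → ℕ
decrementAt t f i with i ≟ t
... | yes _ = f i ∸ 1
... | no  _ = f i

decrementAt-≢ : ∀ {n} {t i : Fin n} (f : Fin n → ℕ) → i ≢ t → decrementAt t f i ≡ f i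
decrementAt-≢ {t = t} {i} f i≢t with i ≟ t
... | yes i≡t = contradiction i≡t i≢t
... | no  _   = refl

decrementAt-self : ∀ {n} (t : Fin n) {f : Fin n → ℕ} → 0 < f t → f t ≡ decrementAt t f t + 1
decrementAt-self t {f} ft>0 with t ≟ t
... | yes _   = sym (m∸n+n≡m ft>0)
... | no  t≢t = contradiction refl t≢t

decrementAt-≤ : ∀ {n} (t : Fin n) (f : Fin n → ℕ) i → decrementAt t f i ≤ f i
decrementAt-≤ t f i with i ≟ t
... | yes _ = m∸n≤m (f i) 1
... | no  _ = ≤-refl

Σℕ-decrementAt : ∀ {n} (t : Fin n) {f : Fin n → ℕ} (h : Fin n → ℕ → ℕ) →
                 (∀ a → h t (a + 1) ≡ h t a + h t 1) → 0 < f t →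
                 Σℕ n (λ i → h i (f i)) ≡ Σℕ n (λ i → h i (decrementAt t f i)) + h t 1
Σℕ-decrementAt t {f} h additive ft>0 =
  Σℕ-differAt t (λ i i≢t → cong (h i) (sym (decrementAt-≢ f i≢t)))
                (trans (cong (h t) (decrementAt-self t ft>0)) (additive _))

Σℕ-decrementAt-< : ∀ {n} (t : Fin n) {f : Fin n → ℕ} → 0 < f t → Σℕ n (decrementAt t f) < Σℕ n f
Σℕ-decrementAt-< {n} t {f} ft>0 =
  subst (Σℕ n (decrementAt t f) <_) (sym (Σℕ-decrementAt t (λ _ a → a) (λ _ → refl) ft>0))
        (m<m+n _ (s≤s z≤n))

if-then-0-distrib-+ : ∀ b m n →
  (if b then m + n else 0) ≡ (if b then m else 0) + (if b then n else 0)
if-then-0-distrib-+ true  m n = refl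
if-then-0-distrib-+ false m n = refl

m∸n+o+n≡m+o : ∀ {m n} o → n ≤ m → m ∸ n + o + n ≡ m + o
m∸n+o+n≡m+o {m} {n} o n≤m = trans (xy∙z≈xz∙y (m ∸ n) o n) (cong (_+ o) (m∸n+n≡m n≤m))

+a-+b≡+c-+d⇔a+d≡c+b : ∀ a b c d → ℕ→ℤ a -ℤ ℕ→ℤ b ≡ ℕ→ℤ c -ℤ ℕ→ℤ d ⇔ a + d ≡ c + b
+a-+b≡+c-+d⇔a+d≡c+b a b c d = mk⇔
  (λ e → ℤ.+-injective (begin
    x +ℤ v                 ≡⟨ [x-y]+[y+v]≡x+v x y v ⟨
    (x -ℤ y) +ℤ (y +ℤ v)   ≡⟨ cong (_+ℤ (y +ℤ v)) e ⟩
    (u -ℤ v) +ℤ (y +ℤ v)   ≡⟨ cong ((u -ℤ v) +ℤ_) (ℤ.+-comm y v) ⟩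
    (u -ℤ v) +ℤ (v +ℤ y)   ≡⟨ [x-y]+[y+v]≡x+v u v y ⟩
    u +ℤ y                 ∎))
  (λ e → begin
    x -ℤ y                 ≡⟨ [x+v]-[y+v]≡x-y x y v ⟨
    (x +ℤ v) -ℤ (y +ℤ v)   ≡⟨ cong (_-ℤ (y +ℤ v)) (cong ℕ→ℤ e) ⟩
    (u +ℤ y) -ℤ (y +ℤ v)   ≡⟨ cong ((u +ℤ y) -ℤ_) (ℤ.+-comm y v) ⟩
    (u +ℤ y) -ℤ (v +ℤ y)   ≡⟨ [x+v]-[y+v]≡x-y u v y ⟩
    u -ℤ v                 ∎)
  where
  open ≡-Reasoning
  x y u v : ℤ
  x = ℕ→ℤ a; y = ℕ→ℤ b; u = ℕ→ℤ c; v = ℕ→ℤ d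
  [x-y]+[y+v]≡x+v : ∀ x y v → (x -ℤ y) +ℤ (y +ℤ v) ≡ x +ℤ v
  [x-y]+[y+v]≡x+v = solve-∀
  [x+v]-[y+v]≡x-y : ∀ x y v → (x +ℤ v) -ℤ (y +ℤ v) ≡ x -ℤ y
  [x+v]-[y+v]≡x-y = solve-∀

+a≡+b-+c⇔a+c≡b : ∀ a b c → ℕ→ℤ a ≡ ℕ→ℤ b -ℤ ℕ→ℤ c ⇔ a + c ≡ b
+a≡+b-+c⇔a+c≡b a b c = mk⇔
  (λ e → ℤ.+-injective (trans (cong (_+ℤ ℕ→ℤ c) e) ([u-v]+v≡u (ℕ→ℤ b) (ℕ→ℤ c))))
  (λ e → trans (sym ([x+v]-v≡x (ℕ→ℤ a) (ℕ→ℤ c))) (cong (λ n → ℕ→ℤ n -ℤ ℕ→ℤ c) e))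
  where
  [u-v]+v≡u : ∀ u v → (u -ℤ v) +ℤ v ≡ u
  [u-v]+v≡u = solve-∀
  [x+v]-v≡x : ∀ x v → (x +ℤ v) -ℤ v ≡ x
  [x+v]-v≡x = solve-∀

ℕ→ℚ≡mkℚ : ∀ n → ℕ→ℚ n ≡ mkℚ (ℕ→ℤ n) 0 (coprime-sym (1-coprimeTo n))
ℕ→ℚ≡mkℚ n = ℚ.normalize-coprime (coprime-sym (1-coprimeTo n))

ℕ→ℚ-mono-≤ : ∀ {m n} → m ≤ n → ℕ→ℚ m ℚ.≤ ℕ→ℚ n
ℕ→ℚ-mono-≤ {m} {n} m≤n rewrite ℕ→ℚ≡mkℚ m | ℕ→ℚ≡mkℚ n =
  ℚ.*≤* (subst₂ _≤ℤ_ (sym (ℤ.*-identityʳ (ℕ→ℤ m))) (sym (ℤ.*-identityʳ (ℕ→ℤ n))) (+≤+ m≤n))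

threshold-cong : ∀ {nΓ nΠ} (gd : Guard nΓ nΠ) {p p' : Fin nΠ → ℕ} → p ≗ p' →
                 threshold gd p ≡ threshold gd p'
threshold-cong {nΠ = nΠ} gd p≗p' = cong (Guard.a₀ gd ℚ.+_)
  (sumFin-cong ℚ.0ℚ ℚ._+_ nΠ (λ i → cong (λ v → Guard.coeff gd i ℚ.* ℕ→ℚ v) (p≗p' i)))

SatGuard-between : ∀ {nΓ nΠ} (gd : Guard nΓ nΠ) {p p' : Fin nΠ → ℕ} {g₀ g₁ g₂ : Fin nΓ → ℕ} →
  threshold gd p ≡ threshold gd p' →
  g₀ (Guard.var gd) ≤ g₁ (Guard.var gd) → g₁ (Guard.var gd) ≤ g₂ (Guard.var gd) →
  (SatGuard gd g₀ p ⇔ SatGuard gd g₂ p') → (SatGuard gd g₁ p ⇔ SatGuard gd g₂ p')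
SatGuard-between gd {g₁ = g₁} {g₂} th g₀≤g₁ g₁≤g₂ sat₀⇔sat₂ with Guard.kind gd
... | rise = mk⇔
  (λ s → subst (ℚ._≤ ℕ→ℚ (g₂ (Guard.var gd))) th (ℚ.≤-trans s (ℕ→ℚ-mono-≤ g₁≤g₂)))
  (λ s → ℚ.≤-trans (Equivalence.from sat₀⇔sat₂ s) (ℕ→ℚ-mono-≤ g₀≤g₁))
... | fall = mk⇔
  (λ s → Equivalence.to sat₀⇔sat₂ (ℚ.≤-<-trans (ℕ→ℚ-mono-≤ g₀≤g₁) s))
  (λ s → subst (ℕ→ℚ (g₁ (Guard.var gd)) ℚ.<_) (sym th) (ℚ.≤-<-trans (ℕ→ℚ-mono-≤ g₁≤g₂) s))

All-SatGuard-between : ∀ {nΓ nΠ} (gs : List (Guard nΓ nΠ))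
  {p p' : Fin nΠ → ℕ} {g₀ g₁ g₂ : Fin nΓ → ℕ} →
  p ≗ p' → (∀ z → g₀ z ≤ g₁ z) → (∀ z → g₁ z ≤ g₂ z) →
  All (λ gd → SatGuard gd g₀ p ⇔ SatGuard gd g₂ p') gs →
  All (λ gd → SatGuard gd g₁ p ⇔ SatGuard gd g₂ p') gs
All-SatGuard-between gs p≗p' g₀≤g₁ g₁≤g₂ =
  All.map (λ {gd} → SatGuard-between gd (threshold-cong gd p≗p') (g₀≤g₁ _) (g₁≤g₂ _))

All-⇔-transport : ∀ {X : Set} {P Q R : X → Set} {xs : List X} →
  All (λ x → P x ⇔ R x) xs → All (λ x → Q x ⇔ R x) xs → All P xs → All Q xs
All-⇔-transport []       []       []       = []
All-⇔-transport (e ∷ es) (f ∷ fs) (s ∷ ss) =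
  Equivalence.from f (Equivalence.to e s) ∷ All-⇔-transport es fs ss

module _ (A : TA) where
  open TA A

  ind-refl : ∀ a → ind A a a ≡ 1
  ind-refl a with a ≟ a
  ... | yes _   = refl
  ... | no  a≢a = contradiction refl a≢a

  ind-≢ : ∀ {a b} → a ≢ b → ind A a b ≡ 0
  ind-≢ {a} {b} a≢b with a ≟ b
  ... | yes a≡b = contradiction a≡b a≢b
  ... | no  _   = refl

  ind-sym : ∀ a b → ind A a b ≡ ind A b a
  ind-sym a b with a ≟ b
  ... | yes refl = sym (ind-refl a)
  ... | no  a≢b  = sym (ind-≢ (λ b≡a → a≢b (sym b≡a)))

  ind-from-≤-κ : ∀ (σ : Conf A) r ℓ → 0 < κ σ (from A r) → ind A ℓ (from A r) ≤ κ σ ℓ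
  ind-from-≤-κ σ r ℓ occ with ℓ ≟ from A r
  ... | yes refl = occ
  ... | no  _    = z≤n

  applyRule-κ : ∀ {σ : Conf A} r ℓ → 0 < κ σ (from A r) →
                κ (applyRule A r σ) ℓ + ind A (from A r) ℓ ≡ κ σ ℓ + ind A (to A r) ℓ
  applyRule-κ {σ} r ℓ occ = begin
    κ (applyRule A r σ) ℓ + ind A (from A r) ℓ ≡⟨ cong (κ (applyRule A r σ) ℓ +_) (ind-sym _ ℓ) ⟩
    κ (applyRule A r σ) ℓ + ind A ℓ (from A r) ≡⟨ m∸n+o+n≡m+o _ (ind-from-≤-κ σ r ℓ occ) ⟩
    κ σ ℓ + ind A ℓ (to A r)                   ≡⟨ cong (κ σ ℓ +_) (ind-sym ℓ _) ⟩
    κ σ ℓ + ind A (to A r) ℓ                   ∎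
    where open ≡-Reasoning

  applyRule-occupies-to : ∀ {σ : Conf A} r → 0 < κ (applyRule A r σ) (to A r)
  applyRule-occupies-to r = ≤-trans (≤-reflexive (sym (ind-refl (to A r)))) (m≤n+m _ _)

  applyRule-occupied : ∀ {σ : Conf A} r {ℓ} → ℓ ≢ from A r → 0 < κ σ ℓ → 0 < κ (applyRule A r σ) ℓ
  applyRule-occupied {σ} r {ℓ} ℓ≢from occ =
    ≤-trans occ (≤-trans (≤-reflexive (cong (κ σ ℓ ∸_) (sym (ind-≢ ℓ≢from)))) (m≤m+n _ _))

  SameContext-applyRule : ∀ {σ σ' : Conf A} r → p σ ≗ p σ' →
    (∀ z → g (applyRule A r σ) z ≤ g σ' z) → SameContext A σ σ' → SameContext A (applyRule A r σ) σ'
  SameContext-applyRule r p≗p' below ctx r' =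
    All-SatGuard-between (Rule.guard (rules r')) p≗p' (λ z → m≤m+n _ _) below (ctx r')

  CondR-transfer : ∀ {σ τ σ' : Conf A} {X X' : Assignment A} →
    SameContext A σ σ' → SameContext A τ σ' → (∀ r → X' r ≤ X r) → CondR A σ X → CondR A τ X'
  CondR-transfer ctx ctx' X'≤X sat r x'>0 =
    All-⇔-transport (ctx r) (ctx' r) (sat r (<-≤-trans x'>0 (X'≤X r)))

  increment : Assignment A → Fin nΓ → ℕ
  increment X z = Σℕ nR (λ r → X r * b2n (Rule.upd (rules r) z))

  SharedBalance : Conf A → Conf A → Assignment A → Set
  SharedBalance σ σ' X = ∀ z → increment X z + g σ z ≡ g σ' z

  CondΓ⇔SharedBalance : ∀ (σ σ' : Conf A) X → CondΓ A σ σ' X ⇔ SharedBalance σ σ' X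
  CondΓ⇔SharedBalance σ σ' X = mk⇔
    (λ c z → Equivalence.to (balance z) (c z))
    (λ b z → Equivalence.from (balance z) (b z))
    where
    balance : ∀ z → ℕ→ℤ (increment X z) ≡ ℕ→ℤ (g σ' z) -ℤ ℕ→ℤ (g σ z)
                    ⇔ increment X z + g σ z ≡ g σ' z
    balance z = +a≡+b-+c⇔a+c≡b (increment X z) (g σ' z) (g σ z)

  SharedBalance-≤ : ∀ {σ σ' : Conf A} {X} → SharedBalance σ σ' X → ∀ z → g σ z ≤ g σ' z
  SharedBalance-≤ {σ} bal z = subst (g σ z ≤_) (bal z) (m≤n+m _ _)

  SharedBalance-applyRule : ∀ {σ σ' : Conf A} {Y} t → 0 < Y t →
    SharedBalance σ σ' Y → SharedBalance (applyRule A t σ) σ' (decrementAt t Y)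
  SharedBalance-applyRule {σ} {σ'} {Y} t Yt>0 bal z = begin
    increment Z z + (g σ z + u t) ≡⟨ x∙yz≈xz∙y (increment Z z) _ _ ⟩
    increment Z z + u t + g σ z   ≡⟨ cong (_+ g σ z) increment-decrementAt ⟨
    increment Y z + g σ z         ≡⟨ bal z ⟩
    g σ' z                        ∎
    where
    open ≡-Reasoning
    Z : Assignment A
    Z = decrementAt t Y
    u : RuleIx A → ℕ
    u r = b2n (Rule.upd (rules r) z)
    increment-decrementAt : increment Y z ≡ increment Z z + u t
    increment-decrementAt =
      trans (Σℕ-decrementAt t (λ r a → a * u r) (λ a → *-distribʳ-+ (u t) a 1) Yt>0)
            (cong (increment Z z +_) (*-identityˡ (u t)))

  inflow outflow : Assignment A → Loc A → ℕ
  inflow  X ℓ = Σℕ nR (λ r → if ⌊ to A r ≟ ℓ ⌋ then X r else 0)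
  outflow X ℓ = Σℕ nR (λ r → if ⌊ from A r ≟ ℓ ⌋ then X r else 0)

  FlowBalance : Conf A → Conf A → Assignment A → Set
  FlowBalance σ σ' X = ∀ ℓ → inflow X ℓ + κ σ ℓ ≡ κ σ' ℓ + outflow X ℓ

  CondL⇔FlowBalance : ∀ (σ σ' : Conf A) X → CondL A σ σ' X ⇔ FlowBalance σ σ' X
  CondL⇔FlowBalance σ σ' X = mk⇔
    (λ c ℓ → Equivalence.to (balance ℓ) (trans (sym (flows-ℤ ℓ)) (c ℓ)))
    (λ b ℓ → trans (flows-ℤ ℓ) (Equivalence.from (balance ℓ) (b ℓ)))
    where
    balance : ∀ ℓ → ℕ→ℤ (inflow X ℓ) -ℤ ℕ→ℤ (outflow X ℓ) ≡ ℕ→ℤ (κ σ' ℓ) -ℤ ℕ→ℤ (κ σ ℓ)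
                    ⇔ inflow X ℓ + κ σ ℓ ≡ κ σ' ℓ + outflow X ℓ
    balance ℓ = +a-+b≡+c-+d⇔a+d≡c+b (inflow X ℓ) (outflow X ℓ) (κ σ' ℓ) (κ σ ℓ)
    flows-ℤ : ∀ ℓ →
      Σℤ nR (λ r → ℕ→ℤ (if ⌊ to A r ≟ ℓ ⌋ then X r else 0))
        -ℤ Σℤ nR (λ r → ℕ→ℤ (if ⌊ from A r ≟ ℓ ⌋ then X r else 0))
      ≡ ℕ→ℤ (inflow X ℓ) -ℤ ℕ→ℤ (outflow X ℓ)
    flows-ℤ ℓ = cong₂ _-ℤ_ (Σℤ-ℕ→ℤ nR _) (Σℤ-ℕ→ℤ nR _)

  FlowBalance-applyRule : ∀ {σ σ' : Conf A} {Y} t → 0 < κ σ (from A t) → 0 < Y t →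
    FlowBalance σ σ' Y → FlowBalance (applyRule A t σ) σ' (decrementAt t Y)
  FlowBalance-applyRule {σ} {σ'} {Y} t occ Yt>0 bal ℓ = +-cancelʳ-≡ (ind A (from A t) ℓ) _ _ (begin
    inflow Z ℓ + κ σ₁ ℓ + ind A (from A t) ℓ     ≡⟨ +-assoc (inflow Z ℓ) _ _ ⟩
    inflow Z ℓ + (κ σ₁ ℓ + ind A (from A t) ℓ)   ≡⟨ cong (inflow Z ℓ +_) (applyRule-κ {σ} t ℓ occ) ⟩
    inflow Z ℓ + (κ σ ℓ + ind A (to A t) ℓ)      ≡⟨ x∙yz≈xz∙y (inflow Z ℓ) _ _ ⟩
    inflow Z ℓ + ind A (to A t) ℓ + κ σ ℓ        ≡⟨ cong (_+ κ σ ℓ) (flow-decrementAt (to A)) ⟨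
    inflow Y ℓ + κ σ ℓ                           ≡⟨ bal ℓ ⟩
    κ σ' ℓ + outflow Y ℓ                         ≡⟨ cong (κ σ' ℓ +_) (flow-decrementAt (from A)) ⟩
    κ σ' ℓ + (outflow Z ℓ + ind A (from A t) ℓ)  ≡⟨ +-assoc (κ σ' ℓ) _ _ ⟨
    κ σ' ℓ + outflow Z ℓ + ind A (from A t) ℓ    ∎)
    where
    open ≡-Reasoning
    σ₁ : Conf A
    σ₁ = applyRule A t σ
    Z : Assignment A
    Z = decrementAt t Y
    flow-decrementAt : ∀ (end : RuleIx A → Loc A) →
      Σℕ nR (λ r → if ⌊ end r ≟ ℓ ⌋ then Y r else 0)
        ≡ Σℕ nR (λ r → if ⌊ end r ≟ ℓ ⌋ then Z r else 0) + ind A (end t) ℓ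
    flow-decrementAt end = Σℕ-decrementAt t (λ r a → if ⌊ end r ≟ ℓ ⌋ then a else 0)
                                           (λ a → if-then-0-distrib-+ _ a 1) Yt>0

  Reachable : Conf A → Assignment A → Loc A → Set
  Reachable σ X ℓ = 0 < κ σ ℓ ⊎ ∃[ r ] (ApplChain A σ X r × to A r ≡ ℓ)

  ApplChain-positive : ∀ {σ X r} → ApplChain A σ X r → 0 < X r
  ApplChain-positive (start x>0 _)  = x>0
  ApplChain-positive (step _ x>0 _) = x>0

  ApplChain-extend : ∀ {σ X r} → 0 < X r → Reachable σ X (from A r) → ApplChain A σ X r
  ApplChain-extend x>0 (inj₁ occ)              = start x>0 occ
  ApplChain-extend x>0 (inj₂ (_ , chain , eq)) = step chain x>0 eq

  ApplChain-transfer : ∀ {σ τ X Z} →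
    (∀ {ℓ} → 0 < κ σ ℓ → Reachable τ Z ℓ) →
    (∀ {r} → 0 < X r → Reachable τ Z (from A r) → Reachable τ Z (to A r)) →
    ∀ {r} → ApplChain A σ X r → Reachable τ Z (from A r)
  ApplChain-transfer occupied closed (start _ occ) = occupied occ
  ApplChain-transfer occupied closed (step chain _ eq) =
    subst (Reachable _ _) eq
          (closed (ApplChain-positive chain) (ApplChain-transfer occupied closed chain))

  Linked-closed : (P : Loc A → Set) {X : Assignment A} →
    (∀ {r} → 0 < X r → P (from A r) → P (to A r)) →
    ∀ {t} ts → Linked A t ts → All (λ r → 0 < X r) ts → P (to A t) → P (to A (lastOf A t ts))
  Linked-closed P closed []        _            _            Pt = Pt
  Linked-closed P closed (t' ∷ ts) (eq , linked) (x>0 ∷ x>0s) Pt =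
    Linked-closed P closed ts linked x>0s (closed x>0 (subst P eq Pt))

  CondAppl-applyRule : ∀ {σ : Conf A} {Y ℓ t ts} → 0 < κ σ ℓ → FireableCycle A Y ℓ t ts →
    CondAppl A σ Y → CondAppl A (applyRule A t σ) (decrementAt t Y)
  CondAppl-applyRule {σ} {Y} {ℓ} {t} {ts} occ (Y>0 , linked , from≡ℓ , last≡ℓ) appl r Zr>0 =
    ApplChain-extend Zr>0
      (ApplChain-transfer occupied closed (appl r (<-≤-trans Zr>0 (decrementAt-≤ t Y r))))
    where
    σ₁ : Conf A
    σ₁ = applyRule A t σ
    Z : Assignment A
    Z = decrementAt t Y
    closed : ∀ {r} → 0 < Y r → Reachable σ₁ Z (from A r) → Reachable σ₁ Z (to A r)
    closed {r} Yr>0 reach with r ≟ t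
    ... | yes refl = inj₁ (applyRule-occupies-to {σ} t)
    ... | no  r≢t  =
      inj₂ (r , ApplChain-extend (subst (0 <_) (sym (decrementAt-≢ Y r≢t)) Yr>0) reach , refl)
    ℓ-reachable : Reachable σ₁ Z ℓ
    ℓ-reachable = subst (Reachable σ₁ Z) last≡ℓ
      (Linked-closed (Reachable σ₁ Z) closed ts linked (All.tail Y>0)
                     (inj₁ (applyRule-occupies-to {σ} t)))
    occupied : ∀ {ℓ'} → 0 < κ σ ℓ' → Reachable σ₁ Z ℓ'
    occupied {ℓ'} occ' with ℓ' ≟ ℓ
    ... | yes refl  = ℓ-reachable
    ... | no  ℓ'≢ℓ =
      inj₁ (applyRule-occupied {σ} t (λ ℓ'≡from → ℓ'≢ℓ (trans ℓ'≡from from≡ℓ)) occ')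

lemma3 : (A : TA) (σ σ' : Conf A) (Y : Assignment A) (ℓ : Loc A)
         (t₁ : RuleIx A) (ts : List (RuleIx A)) →
         IsConfig A σ → IsConfig A σ' →
         SteadyWith A σ σ' Y →
         0 < Conf.κ σ ℓ →
         FireableCycle A Y ℓ t₁ ts →
         Σ (Assignment A) (λ Z → SteadyWith A (applyRule A t₁ σ) σ' Z × total A Z < total A Y)
lemma3 A σ σ' Y ℓ t₁ ts _ _ ((p≗p' , inRC , N≡N' , ctx) , condL , condΓ , condR , appl)
       occ cycle@(Y>0 , _ , from≡ℓ , _) =
  Z , ((p≗p' , inRC , N≡N' , ctx₁) , condL₁ , condΓ₁ , condR₁ , appl₁) , Σℕ-decrementAt-< t₁ Yt₁>0
  where
  σ₁ : Conf A
  σ₁ = applyRule A t₁ σ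
  Z : Assignment A
  Z = decrementAt t₁ Y
  Yt₁>0 : 0 < Y t₁
  Yt₁>0 = All.head Y>0

  shared₁ : SharedBalance A σ₁ σ' Z
  shared₁ = SharedBalance-applyRule A {σ} {σ'} {Y} t₁ Yt₁>0
              (Equivalence.to (CondΓ⇔SharedBalance A σ σ' Y) condΓ)

  flow₁ : FlowBalance A σ₁ σ' Z
  flow₁ = FlowBalance-applyRule A {σ} {σ'} {Y} t₁ (subst (λ ℓ' → 0 < κ σ ℓ') (sym from≡ℓ) occ)
            Yt₁>0 (Equivalence.to (CondL⇔FlowBalance A σ σ' Y) condL)

  ctx₁ : SameContext A σ₁ σ'
  ctx₁ = SameContext-applyRule A {σ} {σ'} t₁ p≗p' (SharedBalance-≤ A {σ₁} {σ'} {Z} shared₁) ctx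

  condL₁ : CondL A σ₁ σ' Z
  condL₁ = Equivalence.from (CondL⇔FlowBalance A σ₁ σ' Z) flow₁

  condΓ₁ : CondΓ A σ₁ σ' Z
  condΓ₁ = Equivalence.from (CondΓ⇔SharedBalance A σ₁ σ' Z) shared₁

  condR₁ : CondR A σ₁ Z
  condR₁ = CondR-transfer A {σ} {σ₁} {σ'} {Y} ctx ctx₁ (decrementAt-≤ t₁ Y) condR

  appl₁ : CondAppl A σ₁ Z
  appl₁ = CondAppl-applyRule A {σ} {Y} {ℓ} {t₁} {ts} occ cycle appl
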